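{- Assume ZFC (in particular the axiom of choice). A graph $G$ is isomorphic to a generalized Cayley graph $\mathcal{C}\langle\mathsf{G},\mathsf{H}\rangle$ (for some group $\mathsf{G}$, some non-empty subset $\mathsf{H}\subseteq\mathsf{G}$ and some injective labelling $\langle\ \rangle:\mathsf{H}\to A$) if and only if $G$ is deterministic, co-deterministic, vertex-transitive and simple.
   Context: Fix an arbitrary set $A$ of labels. A graph is a non-empty set $G\subseteq V\times A\times V$ of labelled edges $s\xrightarrow{a}t$; $V_G$ is the set of vertices occurring in edges. Isomorphism: bijection $f:V_G\to V_H$ with $s\xrightarrow{a}_G t\iff f(s)\xrightarrow{a}_H f(t)$; automorphism: isomorphism $G\to G$. $G$ is simple if $s\xrightarrow{a}t,\ s\xrightarrow{b}t\Rightarrow a=b$; deterministic if $r\xrightarrow{a}s,\ r\xrightarrow{a}t\Rightarrow s=t$; co-deterministic if $s\xrightarrow{a}r,\ t\xrightarrow{a}r\Rightarrow s=t$; vertex-transitive if for all $s,t\in V_G$ some automorphism maps $s$ to $t$. For a group $(\mathsf{G},\cdot)$, any non-empty subset $\mathsf{H}\subseteq\mathsf{G}$ and injective $\langle\ \rangle:\mathsf{H}\to A$, the generalized Cayley graph is $\mathcal{C}\langle\mathsf{G},\mathsf{H}\rangle=\{(g,\langle h\rangle,g\cdot h)\mid g\in\mathsf{G},h\in\mathsf{H}\}$. -}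

module Defs where

open import Level using (0ℓ)
open import Data.Product using (Σ; Σ-syntax; _×_; _,_; proj₁; proj₂)
open import Data.Sum using (_⊎_; inj₁; inj₂)
open import Relation.Binary.PropositionalEquality using (_≡_; refl)
open import Relation.Binary.Structures using (IsEquivalence)
open import Algebra.Core using (Op₁; Op₂)
open import Algebra.Structures using (IsGroup)
open import Function.Bundles using (_⤖_; _⇔_; Bijection)

-- A graph is presented by its vertex set V (= V_G, so every vertex must
-- occur in some edge) and its edge relation  s ─[ a ]→ t .

record Graph (A : Set) : Set₁ where
  field
    V        : Set
    _─[_]→_  : V → A → V → Set
    nonempty : Σ[ s ∈ V ] Σ[ a ∈ A ] Σ[ t ∈ V ] (s ─[ a ]→ t)
    occurs   : (v : V) → Σ[ a ∈ A ] Σ[ t ∈ V ] ((v ─[ a ]→ t) ⊎ (t ─[ a ]→ v))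

open Graph public

module _ {A : Set} where

  IsIsoVia : (G H : Graph A) → (V G → V H) → Set
  IsIsoVia G H f = ∀ s a t → (_─[_]→_ G s a t) ⇔ (_─[_]→_ H (f s) a (f t))

  _≅_ : Graph A → Graph A → Set
  G ≅ H = Σ[ f ∈ V G ⤖ V H ] IsIsoVia G H (Bijection.to f)

  Automorphism : Graph A → Set
  Automorphism G = Σ[ f ∈ V G ⤖ V G ] IsIsoVia G G (Bijection.to f)

  Simple : Graph A → Set
  Simple G = ∀ s a b t → _─[_]→_ G s a t → _─[_]→_ G s b t → a ≡ b

  Deterministic : Graph A → Set
  Deterministic G = ∀ r a s t → _─[_]→_ G r a s → _─[_]→_ G r a t → s ≡ t

  CoDeterministic : Graph A → Set
  CoDeterministic G = ∀ s a r t → _─[_]→_ G s a r → _─[_]→_ G t a r → s ≡ t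

  VertexTransitive : Graph A → Set
  VertexTransitive G =
    ∀ s t → Σ[ φ ∈ Automorphism G ] Bijection.to (proj₁ φ) s ≡ t

record GroupStructure (X : Set) : Set where
  field
    _∙_     : Op₂ X
    ε       : X
    _⁻¹     : Op₁ X
    isGroup : IsGroup _≡_ _∙_ ε _⁻¹

record ≡-Group : Set₁ where
  field
    Carrier   : Set
    structure : GroupStructure Carrier
  open GroupStructure structure public

record CayleyData (A : Set) (𝔾 : ≡-Group) : Set₁ where
  open ≡-Group 𝔾
  field
    ℍ          : Carrier → Set
    ℍ-prop     : ∀ h (p q : ℍ h) → p ≡ q
    ℍ-nonempty : Σ[ h ∈ Carrier ] ℍ h
    ⟨_⟩        : Σ[ h ∈ Carrier ] ℍ h → A
    ⟨⟩-inj     : ∀ h h′ → ⟨ h ⟩ ≡ ⟨ h′ ⟩ → h ≡ h′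

Cayley : {A : Set} (𝔾 : ≡-Group) → CayleyData A 𝔾 → Graph A
Cayley {A} 𝔾 D = record
  { V        = Carrier
  ; _─[_]→_  = E
  ; nonempty = ε , ⟨ h₀ ⟩ , ε ∙ proj₁ h₀ , h₀ , refl , refl
  ; occurs   = λ v → ⟨ h₀ ⟩ , v ∙ proj₁ h₀ , inj₁ (h₀ , refl , refl)
  }
  where
    open ≡-Group 𝔾
    open CayleyData D
    E : Carrier → A → Carrier → Set
    E g a g′ = Σ[ h ∈ Σ[ h ∈ Carrier ] ℍ h ] (⟨ h ⟩ ≡ a × g ∙ proj₁ h ≡ g′)
    h₀ = ℍ-nonempty

IsGeneralizedCayley : {A : Set} → Graph A → Set₁
IsGeneralizedCayley {A} G = Σ[ 𝔾 ∈ ≡-Group ] Σ[ D ∈ CayleyData A 𝔾 ] (G ≅ Cayley 𝔾 D)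

-- Set-theoretic (ZFC) principles that Agda lacks, assumed explicitly.
-- All three are theorems of ZFC.

record ZFC-Principles : Set₁ where
  field
    funext : {X : Set} {Y : X → Set} {f g : (x : X) → Y x} →
             (∀ x → f x ≡ g x) → f ≡ g
    -- AC: every equivalence relation admits a choice of representatives
    -- (implies excluded middle, by Diaconescu's argument)
    representatives : (X : Set) (R : X → X → Set) → IsEquivalence R →
      Σ[ r ∈ (X → X) ] ((∀ x → R x (r x)) × (∀ x y → R x y → r x ≡ r y))
    -- AC (equivalent form, Hajnal–Kertész): every non-empty set carries a
    -- group structure
    groupOnNonempty : (X : Set) → X → GroupStructure X

module Submission where

-- In a Cayley graph an edge label names the generator, so determinism, co-determinism
-- and simplicity are cancellation laws, and left translations act transitively; all
-- four properties are invariant under isomorphism.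
--
-- Conversely, fix a vertex r₀ and, for each vertex c, an automorphism τ c with
-- τ c r₀ = c. By (co-)determinism two automorphisms that agree at one vertex agree
-- on its whole undirected component, so x · y = τ x y is a group law on the component
-- C₀ of r₀. Choosing a representative c for every component and any group structure
-- on the set of components, (c , x) ↦ τ c x identifies the vertices with the product
-- group, and the edges with right multiplication by (ε , y) for the out-neighbours y
-- of r₀, labelled by their (unique, by simplicity) edge label.

open import Defs
open import Data.Product using (_×_; Σ; Σ-syntax; _,_; proj₁; proj₂)
open import Data.Product.Properties using (Σ-≡,≡→≡)
open import Function.Base using (id; _∘_)
open import Function.Bundles using (_⇔_; _⤖_; _↔_; Bijection; Inverse; Equivalence; mk⇔; mk↔ₛ′)
open import Function.Definitions using (Injective)
open import Function.Properties.Bijection using (⤖⇒↔) renaming (trans to ⤖-trans)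
open import Function.Properties.Equivalence using () renaming (sym to ⇔-sym; trans to ⇔-trans)
open import Function.Properties.Inverse using (↔-sym; ↔⇒⤖)
open import Relation.Binary.PropositionalEquality
open import Relation.Binary.Structures using (IsEquivalence)
import Relation.Binary.Construct.On as On
open import Axiom.UniquenessOfIdentityProofs.WithK using (uip)
open import Level using (0ℓ)
open import Algebra.Core using (Op₁; Op₂)
import Algebra.Definitions as Laws
open import Algebra.Structures using (IsGroup)
open import Algebra.Bundles using (Group)
import Algebra.Properties.Group as GroupProperties

module GroupLaws (𝔾 : ≡-Group) where
  open ≡-Group 𝔾 public
  open IsGroup isGroup public using (assoc; identityˡ; identityʳ; inverseˡ; inverseʳ)

asGroup : ≡-Group → Group 0ℓ 0ℓ
asGroup 𝔾 = record { isGroup = isGroup } where open ≡-Group 𝔾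

isGroup-≡ : {X : Set} {_∙_ : Op₂ X} {ε : X} {_⁻¹ : Op₁ X} →
  Laws.Associative _≡_ _∙_ → Laws.Identity _≡_ ε _∙_ → Laws.Inverse _≡_ ε _⁻¹ _∙_ →
  IsGroup _≡_ _∙_ ε _⁻¹
isGroup-≡ {_∙_ = _∙_} {_⁻¹ = _⁻¹} assoc identity inverse = record
  { isMonoid = record
    { isSemigroup = record
      { isMagma = record { isEquivalence = isEquivalence ; ∙-cong = cong₂ _∙_ }
      ; assoc = assoc }
    ; identity = identity }
  ; inverse = inverse
  ; ⁻¹-cong = cong _⁻¹ }

infixr 2 _×ᴳ_
_×ᴳ_ : ≡-Group → ≡-Group → ≡-Group
𝔸 ×ᴳ 𝔹 = record
  { Carrier = 𝔸.Carrier × 𝔹.Carrier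
  ; structure = record
    { _∙_ = λ (g , h) (g′ , h′) → g 𝔸.∙ g′ , h 𝔹.∙ h′
    ; ε = 𝔸.ε , 𝔹.ε
    ; _⁻¹ = λ (g , h) → g 𝔸.⁻¹ , h 𝔹.⁻¹
    ; isGroup = isGroup-≡
        (λ (g , h) (g′ , h′) (g″ , h″) → cong₂ _,_ (𝔸.assoc g g′ g″) (𝔹.assoc h h′ h″))
        ((λ (g , h) → cong₂ _,_ (𝔸.identityˡ g) (𝔹.identityˡ h)) ,
         (λ (g , h) → cong₂ _,_ (𝔸.identityʳ g) (𝔹.identityʳ h)))
        ((λ (g , h) → cong₂ _,_ (𝔸.inverseˡ g) (𝔹.inverseˡ h)) ,
         (λ (g , h) → cong₂ _,_ (𝔸.inverseʳ g) (𝔹.inverseʳ h)))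
    }
  }
  where module 𝔸 = GroupLaws 𝔸; module 𝔹 = GroupLaws 𝔹

module _ {A : Set} where

  infix 4 _∋_─[_]→_
  _∋_─[_]→_ : (G : Graph A) → V G → A → V G → Set
  G ∋ s ─[ a ]→ t = _─[_]→_ G s a t

  Homomorphism : (G H : Graph A) → (V G → V H) → Set
  Homomorphism G H f = ∀ {s a t} → G ∋ s ─[ a ]→ t → H ∋ f s ─[ a ]→ f t

  module Iso {G H : Graph A} (φ : G ≅ H) where

    private
      inverse : V G ↔ V H
      inverse = ⤖⇒↔ (proj₁ φ)

    to : V G → V H
    to = Bijection.to (proj₁ φ)

    from : V H → V G
    from = Inverse.from inverse

    to∘from : ∀ y → to (from y) ≡ y
    to∘from = Inverse.strictlyInverseˡ inverse

    from∘to : ∀ x → from (to x) ≡ x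
    from∘to = Inverse.strictlyInverseʳ inverse

    injective : Injective _≡_ _≡_ to
    injective = Bijection.injective (proj₁ φ)

    hom : Homomorphism G H to
    hom = Equivalence.to (proj₂ φ _ _ _)

    ≅-sym : H ≅ G
    ≅-sym = ↔⇒⤖ (↔-sym inverse) , λ s a t →
      subst₂ (λ s′ t′ → H ∋ s′ ─[ a ]→ t′ ⇔ G ∋ from s ─[ a ]→ from t)
             (to∘from s) (to∘from t)
             (⇔-sym (proj₂ φ (from s) a (from t)))

  ≅-trans : {G H K : Graph A} → G ≅ H → H ≅ K → G ≅ K
  ≅-trans (f , f-iso) (g , g-iso) =
    ⤖-trans f g , λ s a t → ⇔-trans (f-iso s a t) (g-iso _ a _)

  module Invariance {G H : Graph A} (φ : G ≅ H) where
    private module φ = Iso {G = G} {H = H} φ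

    Deterministic-resp-≅ : Deterministic H → Deterministic G
    Deterministic-resp-≅ det r a s t e e′ = φ.injective (det _ a _ _ (φ.hom e) (φ.hom e′))

    CoDeterministic-resp-≅ : CoDeterministic H → CoDeterministic G
    CoDeterministic-resp-≅ codet s a r t e e′ = φ.injective (codet _ a _ _ (φ.hom e) (φ.hom e′))

    Simple-resp-≅ : Simple H → Simple G
    Simple-resp-≅ simple s a b t e e′ = simple _ a b _ (φ.hom e) (φ.hom e′)

    VertexTransitive-resp-≅ : VertexTransitive H → VertexTransitive G
    VertexTransitive-resp-≅ vt s t =
      ≅-trans {G} {H} {G} φ (≅-trans {H} {H} {G} χ φ.≅-sym) , χs≡t
      where
        χ : Automorphism H
        χ = proj₁ (vt (φ.to s) (φ.to t))
        module χ = Iso {G = H} {H = H} χ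
        χs≡t : φ.from (χ.to (φ.to s)) ≡ t
        χs≡t = trans (cong φ.from (proj₂ (vt (φ.to s) (φ.to t)))) (φ.from∘to t)

module CayleyGraph {A : Set} (𝔾 : ≡-Group) (D : CayleyData A 𝔾) where
  open GroupLaws 𝔾
  open CayleyData D
  open GroupProperties (asGroup 𝔾)
    using (∙-cancelˡ; ∙-cancelʳ; \\-leftDividesˡ; \\-leftDividesʳ; //-rightDividesˡ)

  deterministic : Deterministic (Cayley 𝔾 D)
  deterministic r a s t (h , ⟨h⟩≡a , rh≡s) (h′ , ⟨h′⟩≡a , rh′≡t)
    with ⟨⟩-inj h h′ (trans ⟨h⟩≡a (sym ⟨h′⟩≡a))
  ... | refl = trans (sym rh≡s) rh′≡t

  coDeterministic : CoDeterministic (Cayley 𝔾 D)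
  coDeterministic s a r t (h , ⟨h⟩≡a , sh≡r) (h′ , ⟨h′⟩≡a , th′≡r)
    with ⟨⟩-inj h h′ (trans ⟨h⟩≡a (sym ⟨h′⟩≡a))
  ... | refl = ∙-cancelʳ (proj₁ h) s t (trans sh≡r (sym th′≡r))

  simple : Simple (Cayley 𝔾 D)
  simple s a b t (h , ⟨h⟩≡a , sh≡t) (h′ , ⟨h′⟩≡b , sh′≡t) =
    trans (sym ⟨h⟩≡a) (trans (cong ⟨_⟩ h≡h′) ⟨h′⟩≡b)
    where
      h≡h′ : h ≡ h′
      h≡h′ = Σ-≡,≡→≡ (∙-cancelˡ s _ _ (trans sh≡t (sym sh′≡t)) , ℍ-prop _ _ _)

  leftTranslation : Carrier → Automorphism (Cayley 𝔾 D)
  leftTranslation k =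
    ↔⇒⤖ (mk↔ₛ′ (k ∙_) ((k ⁻¹) ∙_) (\\-leftDividesˡ k) (\\-leftDividesʳ k)) ,
    λ g a g′ → mk⇔
      (λ (h , ⟨h⟩≡a , gh≡g′) → h , ⟨h⟩≡a , trans (assoc k g (proj₁ h)) (cong (k ∙_) gh≡g′))
      (λ (h , ⟨h⟩≡a , kgh≡kg′) → h , ⟨h⟩≡a ,
        ∙-cancelˡ k _ _ (trans (sym (assoc k g (proj₁ h))) kgh≡kg′))

  vertexTransitive : VertexTransitive (Cayley 𝔾 D)
  vertexTransitive s t = leftTranslation (t ∙ (s ⁻¹)) , //-rightDividesˡ s t

module Walks {A : Set} (G : Graph A) where

  data Walk : V G → V G → Set where
    []       : ∀ {u} → Walk u u
    forward  : ∀ {u w v a} → G ∋ u ─[ a ]→ w → Walk w v → Walk u v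
    backward : ∀ {u w v a} → G ∋ w ─[ a ]→ u → Walk w v → Walk u v

  _++_ : ∀ {u v w} → Walk u v → Walk v w → Walk u w
  []           ++ q = q
  forward e p  ++ q = forward e (p ++ q)
  backward e p ++ q = backward e (p ++ q)

  reverse : ∀ {u v} → Walk u v → Walk v u
  reverse []           = []
  reverse (forward e p)  = reverse p ++ backward e []
  reverse (backward e p) = reverse p ++ forward e []

  Walk-isEquivalence : IsEquivalence Walk
  Walk-isEquivalence = record { refl = [] ; sym = reverse ; trans = _++_ }

  map : {f : V G → V G} → Homomorphism G G f → ∀ {u v} → Walk u v → Walk (f u) (f v)
  map f-hom []             = []
  map f-hom (forward e p)  = forward (f-hom e) (map f-hom p)
  map f-hom (backward e p) = backward (f-hom e) (map f-hom p)

  module _ (det : Deterministic G) (codet : CoDeterministic G)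
           {f g : V G → V G} (f-hom : Homomorphism G G f) (g-hom : Homomorphism G G g) where

    -- Determinism propagates agreement forwards along an edge, co-determinism backwards.
    homomorphisms-agree-along : ∀ {u v} → f u ≡ g u → Walk u v → f v ≡ g v
    homomorphisms-agree-along fu≡gu [] = fu≡gu
    homomorphisms-agree-along fu≡gu (forward {a = a} e p) = homomorphisms-agree-along
      (det _ a _ _ (subst (λ x → G ∋ x ─[ a ]→ f _) fu≡gu (f-hom e)) (g-hom e)) p
    homomorphisms-agree-along fu≡gu (backward {a = a} e p) = homomorphisms-agree-along
      (codet _ a _ _ (subst (λ x → G ∋ f _ ─[ a ]→ x) fu≡gu (f-hom e)) (g-hom e)) p

module CayleyRepresentation (Z : ZFC-Principles) {A : Set} (G : Graph A)
  (det : Deterministic G) (codet : CoDeterministic G)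
  (vt : VertexTransitive G) (simple : Simple G) where
  open ZFC-Principles Z
  open Walks G

  r₀ : V G
  r₀ = proj₁ (nonempty G)

  translation : V G → Automorphism G
  translation c = proj₁ (vt r₀ c)

  private module T (c : V G) = Iso {G = G} {H = G} (translation c)

  τ τ⁻¹ : V G → V G → V G
  τ   = T.to
  τ⁻¹ = T.from

  τ-hom : ∀ c → Homomorphism G G (τ c)
  τ-hom = T.hom

  τ⁻¹-hom : ∀ c → Homomorphism G G (τ⁻¹ c)
  τ⁻¹-hom c = Iso.hom {G = G} {H = G} (T.≅-sym c)

  τ-r₀ : ∀ c → τ c r₀ ≡ c
  τ-r₀ c = proj₂ (vt r₀ c)

  τ⁻¹-self : ∀ c → τ⁻¹ c c ≡ r₀
  τ⁻¹-self c = trans (cong (τ⁻¹ c) (sym (τ-r₀ c))) (T.from∘to c r₀)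

  private
    componentChoice = representatives (V G) Walk Walk-isEquivalence

  component : V G → V G
  component = proj₁ componentChoice

  walk-to-component : ∀ x → Walk x (component x)
  walk-to-component = proj₁ (proj₂ componentChoice)

  component-cong : ∀ {x y} → Walk x y → component x ≡ component y
  component-cong = proj₂ (proj₂ componentChoice) _ _

  component-idem : ∀ x → component (component x) ≡ component x
  component-idem x = sym (component-cong (walk-to-component x))

  walk-within : ∀ {x y} → component x ≡ component y → Walk x y
  walk-within {x} {y} eq =
    walk-to-component x ++ subst (λ c → Walk c y) (sym eq) (reverse (walk-to-component y))

  InC₀ : V G → Set
  InC₀ x = component x ≡ component r₀

  C₀ : Set
  C₀ = Σ (V G) InC₀

  C₀-≡ : {x y : C₀} → proj₁ x ≡ proj₁ y → x ≡ y
  C₀-≡ eq = Σ-≡,≡→≡ (eq , uip _ _)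

  edge-InC₀ : ∀ {a y} → G ∋ r₀ ─[ a ]→ y → InC₀ y
  edge-InC₀ e = sym (component-cong (forward e []))

  τ-component : ∀ c {y} → InC₀ y → component (τ c y) ≡ component c
  τ-component c {y} y∈ = sym (component-cong
    (subst (λ x → Walk x (τ c y)) (τ-r₀ c) (map (τ-hom c) (walk-within (sym y∈)))))

  τ⁻¹-InC₀ : ∀ {c y} → component y ≡ component c → InC₀ (τ⁻¹ c y)
  τ⁻¹-InC₀ {c} {y} eq = sym (component-cong
    (subst (λ x → Walk x (τ⁻¹ c y)) (τ⁻¹-self c) (map (τ⁻¹-hom c) (walk-within (sym eq)))))

  agree-on-C₀ : {f g : V G → V G} → Homomorphism G G f → Homomorphism G G g →
                f r₀ ≡ g r₀ → ∀ {z} → InC₀ z → f z ≡ g z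
  agree-on-C₀ f-hom g-hom eq z∈ =
    homomorphisms-agree-along det codet f-hom g-hom eq (walk-within (sym z∈))

  τ∘τ : ∀ c x {y} → InC₀ y → τ c (τ x y) ≡ τ (τ c x) y
  τ∘τ c x = agree-on-C₀ (λ e → τ-hom c (τ-hom x e)) (τ-hom (τ c x))
    (trans (cong (τ c) (τ-r₀ x)) (sym (τ-r₀ (τ c x))))

  ℂ₀ : ≡-Group
  ℂ₀ = record
    { Carrier = C₀
    ; structure = record
      { _∙_ = _·_ ; ε = r₀ , refl ; _⁻¹ = inv
      ; isGroup = isGroup-≡
          (λ (x , _) (y , _) (z , z∈) → C₀-≡ (sym (τ∘τ x y z∈)))
          ((λ (z , z∈) → C₀-≡ (agree-on-C₀ (τ-hom r₀) id (τ-r₀ r₀) z∈)) ,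
           (λ (x , _) → C₀-≡ (τ-r₀ x)))
          ((λ (x , x∈) → C₀-≡ (trans (agree-on-C₀ (τ-hom _) (τ⁻¹-hom x) (τ-r₀ _) x∈)
                                      (τ⁻¹-self x))) ,
           (λ (x , _) → C₀-≡ (T.to∘from x r₀)))
      }
    }
    where
      _·_ : C₀ → C₀ → C₀
      (x , x∈) · (y , y∈) = τ x y , trans (τ-component x y∈) x∈
      inv : C₀ → C₀
      inv (x , x∈) = τ⁻¹ x r₀ , τ⁻¹-InC₀ (sym x∈)

  Component : Set
  Component = Σ (V G) (λ c → component c ≡ c)

  𝕊 : ≡-Group
  𝕊 = record
    { Carrier = Component
    ; structure = groupOnNonempty Component (component r₀ , component-idem r₀)
    }

  𝕂 : ≡-Group
  𝕂 = 𝕊 ×ᴳ ℂ₀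

  open ≡-Group 𝕂 using (_∙_)
  private module 𝕊 = GroupLaws 𝕊

  Ψ : ≡-Group.Carrier 𝕂 → V G
  Ψ ((c , _) , (x , _)) = τ c x

  Ψ-bijection : ≡-Group.Carrier 𝕂 ⤖ V G
  Ψ-bijection = ↔⇒⤖ (mk↔ₛ′ Ψ Φ (λ v → T.to∘from (component v) v) Φ∘Ψ)
    where
      Φ : V G → ≡-Group.Carrier 𝕂
      Φ v = (component v , component-idem v) ,
            (τ⁻¹ (component v) v , τ⁻¹-InC₀ (sym (component-idem v)))

      Φ∘Ψ : ∀ k → Φ (Ψ k) ≡ k
      Φ∘Ψ ((c , c-fixed) , (x , x∈)) = cong₂ _,_
        (Σ-≡,≡→≡ (component-Ψ , uip _ _))
        (C₀-≡ (trans (cong (λ c′ → τ⁻¹ c′ (τ c x)) component-Ψ) (T.from∘to c x)))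
        where
          component-Ψ : component (τ c x) ≡ c
          component-Ψ = trans (τ-component c x∈) c-fixed

  Ψ-∙ : ∀ k y → Ψ (k ∙ (𝕊.ε , y)) ≡ τ (Ψ k) (proj₁ y)
  Ψ-∙ ((c , c-fixed) , (x , _)) (y , y∈) = trans
    (cong (λ c′ → τ (proj₁ c′) (τ x y)) (𝕊.identityʳ (c , c-fixed)))
    (τ∘τ c x y∈)

  OutEdge : Set
  OutEdge = Σ[ a ∈ A ] Σ[ y ∈ V G ] G ∋ r₀ ─[ a ]→ y

  target : OutEdge → V G
  target = proj₁ ∘ proj₂

  private
    canonicalChoice = representatives OutEdge (λ p q → target p ≡ target q)
                                      (On.isEquivalence target isEquivalence)

  canonical : OutEdge → OutEdge
  canonical = proj₁ canonicalChoice

  target-canonical : ∀ p → target p ≡ target (canonical p)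
  target-canonical = proj₁ (proj₂ canonicalChoice)

  canonical-cong : ∀ {p q} → target p ≡ target q → canonical p ≡ canonical q
  canonical-cong = proj₂ (proj₂ canonicalChoice) _ _

  -- ℍ must be proposition-valued, so of the edges from r₀ to y only a chosen one is kept.
  CanonicalEdgeTo : V G → Set
  CanonicalEdgeTo y = Σ[ p ∈ OutEdge ] canonical p ≡ p × target p ≡ y

  CanonicalEdgeTo-prop : ∀ {y} (q q′ : CanonicalEdgeTo y) → q ≡ q′
  CanonicalEdgeTo-prop (p , cp≡p , tp≡y) (p′ , cp′≡p′ , tp′≡y)
    with trans (sym cp≡p) (trans (canonical-cong (trans tp≡y (sym tp′≡y))) cp′≡p′)
  ... | refl = cong₂ (λ u v → p , u , v) (uip cp≡p cp′≡p′) (uip tp≡y tp′≡y)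

  canonicalEdgeTo : ∀ {a y} → G ∋ r₀ ─[ a ]→ y → CanonicalEdgeTo y
  canonicalEdgeTo {a} {y} e =
    canonical p , sym (canonical-cong (target-canonical p)) , sym (target-canonical p)
    where p = a , y , e

  label : ∀ {y} → CanonicalEdgeTo y → A
  label ((a , _) , _) = a

  canonical-edge : ∀ {y} (q : CanonicalEdgeTo y) → G ∋ r₀ ─[ label q ]→ y
  canonical-edge ((a , _ , e) , _ , tp≡y) = subst (G ∋ r₀ ─[ a ]→_) tp≡y e

  label-canonicalEdgeTo : ∀ {a y} (e : G ∋ r₀ ─[ a ]→ y) → label (canonicalEdgeTo e) ≡ a
  label-canonicalEdgeTo e = simple r₀ _ _ _ (canonical-edge (canonicalEdgeTo e)) e

  label-injective : ∀ {y y′} (q : CanonicalEdgeTo y) (q′ : CanonicalEdgeTo y′) →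
                    label q ≡ label q′ → y ≡ y′
  label-injective q q′ eq =
    det r₀ _ _ _ (subst (λ a → G ∋ r₀ ─[ a ]→ _) eq (canonical-edge q)) (canonical-edge q′)

  ℍ : ≡-Group.Carrier 𝕂 → Set
  ℍ (c , y) = c ≡ 𝕊.ε × CanonicalEdgeTo (proj₁ y)

  ℍ-prop : ∀ k (h h′ : ℍ k) → h ≡ h′
  ℍ-prop _ (c≡ε , q) (c≡ε′ , q′) = cong₂ _,_ (uip c≡ε c≡ε′) (CanonicalEdgeTo-prop q q′)

  ⟨_⟩ : Σ _ ℍ → A
  ⟨ _ , _ , q ⟩ = label q

  ⟨⟩-injective : ∀ h h′ → ⟨ h ⟩ ≡ ⟨ h′ ⟩ → h ≡ h′
  ⟨⟩-injective (_ , c≡ε , q) (k′ , c′≡ε , q′) eq = Σ-≡,≡→≡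
    (cong₂ _,_ (trans c≡ε (sym c′≡ε)) (C₀-≡ (label-injective q q′ eq)) , ℍ-prop k′ _ _)

  D : CayleyData A 𝕂
  D = record
    { ℍ          = ℍ
    ; ℍ-prop     = ℍ-prop
    ; ℍ-nonempty = let (_ , y , e) = proj₂ (nonempty G) in
                   (𝕊.ε , (y , edge-InC₀ e)) , refl , canonicalEdgeTo e
    ; ⟨_⟩        = ⟨_⟩
    ; ⟨⟩-inj     = ⟨⟩-injective
    }

  Ψ-iso : IsIsoVia (Cayley 𝕂 D) G Ψ
  Ψ-iso k a k′ = mk⇔ to from
    where
      to : Cayley 𝕂 D ∋ k ─[ a ]→ k′ → G ∋ Ψ k ─[ a ]→ Ψ k′
      to (((_ , y) , refl , q) , refl , refl) =
        subst₂ (G ∋_─[ label q ]→_) (τ-r₀ (Ψ k)) (sym (Ψ-∙ k y)) (τ-hom (Ψ k) (canonical-edge q))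

      from : G ∋ Ψ k ─[ a ]→ Ψ k′ → Cayley 𝕂 D ∋ k ─[ a ]→ k′
      from e = ((𝕊.ε , (y , edge-InC₀ e′)) , refl , canonicalEdgeTo e′) ,
               label-canonicalEdgeTo e′ ,
               Bijection.injective Ψ-bijection
                 (trans (Ψ-∙ k (y , edge-InC₀ e′)) (T.to∘from (Ψ k) (Ψ k′)))
        where
          y = τ⁻¹ (Ψ k) (Ψ k′)
          e′ : G ∋ r₀ ─[ a ]→ y
          e′ = subst (λ x → G ∋ x ─[ a ]→ y) (τ⁻¹-self (Ψ k)) (τ⁻¹-hom (Ψ k) e)

  isGeneralizedCayley : IsGeneralizedCayley G
  isGeneralizedCayley = 𝕂 , D , Iso.≅-sym {G = Cayley 𝕂 D} {H = G} (Ψ-bijection , Ψ-iso)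

theorem4p16 : ZFC-Principles → (A : Set) (G : Graph A) →
    IsGeneralizedCayley G ⇔
      (Deterministic G × CoDeterministic G × VertexTransitive G × Simple G)
theorem4p16 Z A G = mk⇔
  (λ (𝔾 , D , φ) → let open Invariance {G = G} {H = Cayley 𝔾 D} φ
                       open CayleyGraph 𝔾 D in
    Deterministic-resp-≅ deterministic , CoDeterministic-resp-≅ coDeterministic ,
    VertexTransitive-resp-≅ vertexTransitive , Simple-resp-≅ simple)
  (λ (det , codet , vt , simple) →
    CayleyRepresentation.isGeneralizedCayley Z G det codet vt simple)
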